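{- Let $G$ be a graph isomorphic to a daisy cube of order $h$, let $v$ be a minimal vertex of $G$, and let $u$ be a vertex of $G$ of degree $h$. If $\beta$ is an isometric embedding of $G$ into $Q_h$ such that $\beta(u)=0^h$, then the map $V(G)\to B^h$, $w\mapsto\beta(w)\oplus\beta(v)$, is a proper embedding of $G$.
   Context: $B=\{0,1\}$, $B^h$ binary words of length $h$, $Q_h$ the hypercube on $B^h$ (adjacent iff Hamming distance $1$), $\oplus$ bitwise XOR. $u\le v$ means $u_i\le v_i$ for all $i$. For $X\subseteq B^h$ the daisy cube $Q_h(X)$ is the subgraph of $Q_h$ induced by $\{v: v\le x\text{ for some }x\in X\}$; a graph isomorphic to one is a daisy cube of order $h$. An isometric embedding of $G$ into $Q_h$ is a map $V(G)\to B^h$ with Hamming distance equal to graph distance; it is proper if $G$ is isomorphic to $Q_h$ of its image. A vertex $v$ is a minimal vertex of $G$ if some proper embedding of $G$ into $Q_h$ sends $v$ to $0^h$. -}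

module Defs where

open import Data.Nat using (ℕ; zero; suc; _+_; _≤_)
open import Data.Bool as B using (Bool; true; false; _xor_; T; if_then_else_)
open import Data.Fin using (Fin)
open import Data.List using (List; length; filterᵇ; allFin)
open import Data.Vec using (Vec; []; _∷_; zipWith; replicate)
open import Data.Vec.Relation.Binary.Pointwise.Inductive using (Pointwise)
open import Data.Product using (Σ; ∃; ∃-syntax; _×_; _,_)
open import Function.Bundles using (_⇔_)
open import Relation.Binary.PropositionalEquality using (_≡_)
open import Relation.Nullary using (¬_)

Word : ℕ → Set
Word h = Vec Bool h

zeroWord : (h : ℕ) → Word h
zeroWord h = replicate h false

_⊕_ : ∀ {h} → Word h → Word h → Word h
_⊕_ = zipWith _xor_

hamming : ∀ {h} → Word h → Word h → ℕ
hamming []       []       = 0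
hamming (a ∷ u) (b ∷ v) = (if a xor b then 1 else 0) + hamming u v

_≤w_ : ∀ {h} → Word h → Word h → Set
_≤w_ = Pointwise B._≤_

record Graph : Set₁ where
  field
    n      : ℕ
    adj    : Fin n → Fin n → Bool
    sym    : ∀ x y → adj x y ≡ adj y x
    irrefl : ∀ x → adj x x ≡ false

  V : Set
  V = Fin n

  Adj : V → V → Set
  Adj x y = T (adj x y)

  data Walk : V → V → ℕ → Set where
    here : ∀ {x} → Walk x x 0
    step : ∀ {x y z k} → Adj x y → Walk y z k → Walk x z (suc k)

  IsDist : V → V → ℕ → Set
  IsDist x y k = Walk x y k × (∀ m → Walk x y m → k ≤ m)

  degree : V → ℕ
  degree v = length (filterᵇ (adj v) (allFin n))

open Graph public

-- Vertex set of the daisy cube Q_h(X), X ⊆ B^h given as a predicate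
InDaisy : ∀ {h} → (Word h → Set) → Word h → Set
InDaisy X v = ∃[ x ] (X x × v ≤w x)

-- G is isomorphic to the daisy cube Q_h(X) (induced subgraph of Q_h) via f
IsIsoToDaisy : (G : Graph) (h : ℕ) → (Word h → Set) → (V G → Word h) → Set
IsIsoToDaisy G h X f =
    (∀ x → InDaisy X (f x))
  × (∀ x y → f x ≡ f y → x ≡ y)
  × (∀ w → InDaisy X w → ∃[ x ] (f x ≡ w))
  × (∀ x y → Adj G x y ⇔ (hamming (f x) (f y) ≡ 1))

IsoToDaisy : (G : Graph) (h : ℕ) → (Word h → Set) → Set
IsoToDaisy G h X = ∃[ f ] IsIsoToDaisy G h X f

IsDaisyCube : Graph → ℕ → Set₁
IsDaisyCube G h = Σ (Word h → Set) λ X → IsoToDaisy G h X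

IsIsometric : (G : Graph) (h : ℕ) → (V G → Word h) → Set
IsIsometric G h β = ∀ x y → IsDist G x y (hamming (β x) (β y))

Image : ∀ {G : Graph} {h} → (V G → Word h) → Word h → Set
Image {G} β w = ∃[ x ] (β x ≡ w)

IsProper : (G : Graph) (h : ℕ) → (V G → Word h) → Set
IsProper G h β = IsIsometric G h β × IsoToDaisy G h (Image {G} β)

IsMinimal : (G : Graph) (h : ℕ) → V G → Set
IsMinimal G h v = ∃[ γ ] (IsProper G h γ × γ v ≡ zeroWord h)

-- Translate β so that v goes to 0ʰ: b w = β w ⊕ β v is still isometric, and so is the proper
-- embedding γ with γ v = 0ʰ that witnesses minimality of v. Both realise the graph distance, so γ
-- and b induce the same Hamming distances and hence the same weights. The image of γ is
-- downward closed, and this transfers to b by induction on the weight: to clear a set bit i of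
-- b w, clear some set bit j of γ w inside the image of γ; this clears a bit p of b w, and if
-- p ≠ i a second such step, chosen using the induction hypothesis below w, is forced by a
-- distance count to clear i. An isometric map with downward-closed image is proper via itself.

module Submission where

open import Defs hiding (sym)
open import Data.Nat using (ℕ; zero; suc; _+_)
open import Data.Nat.Properties using (≤-antisym; +-suc; suc-injective; n≮n; n≤1⇒n≡0∨n≡1; m≢1+n+m)
open import Data.Bool using (Bool; true; false; not; _xor_; T; if_then_else_; f≤t; b≤b)
open import Data.Bool.Properties using (not-involutive; not-¬; xor-comm)
  renaming (≤-refl to ≤ᵇ-refl)
open import Data.Fin as Fin using (Fin; punchOut; _≟_)
open import Data.Fin.Properties using (any?; punchOut-injective; injective⇒≤)
open import Data.Vec using ([]; _∷_; lookup; _[_]%=_)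
open import Data.Vec.Properties using (lookup-replicate; lookup∘updateAt; lookup∘updateAt′)
open import Data.Vec.Relation.Binary.Pointwise.Inductive as Pointwise using ([]; _∷_)
open import Data.Product using (∃-syntax; _×_; _,_; proj₁; proj₂)
open import Data.Sum using (_⊎_; inj₁; inj₂)
open import Data.Empty using (⊥-elim)
open import Function using (_∘_)
open import Function.Bundles using (_⇔_; mk⇔)
open import Function.Definitions using (Injective)
open import Relation.Binary.PropositionalEquality
  using (_≡_; _≢_; refl; sym; trans; cong; cong₂; subst; subst₂; module ≡-Reasoning)
open import Relation.Nullary using (yes; no; contradiction)

open ≡-Reasoning

injective⇒surjective : ∀ {n} {f : Fin n → Fin n} → Injective _≡_ _≡_ f → ∀ y → ∃[ x ] f x ≡ y
injective⇒surjective {suc n} {f} f-inj y with any? (λ x → f x ≟ y)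
... | yes hit = hit
... | no miss = contradiction (injective⇒≤ punched-injective) (n≮n n)
  where
  punched : Fin (suc n) → Fin n
  punched x = punchOut {i = y} {j = f x} (λ y≡fx → miss (x , sym y≡fx))

  punched-injective : Injective _≡_ _≡_ punched
  punched-injective {x} {x′} = f-inj ∘ punchOut-injective {i = y} {j = f x} {k = f x′} _ _

toggle : ∀ {h} → Fin h → Word h → Word h
toggle i X = X [ i ]%= not

weight : ∀ {h} → Word h → ℕ
weight = hamming (zeroWord _)

indicator : Bool → ℕ
indicator b = if b then 1 else 0

xor-cancelʳ : ∀ a b c → (a xor c) xor (b xor c) ≡ a xor b
xor-cancelʳ true  true  true  = refl
xor-cancelʳ true  true  false = refl
xor-cancelʳ true  false true  = refl
xor-cancelʳ true  false false = refl
xor-cancelʳ false true  true  = refl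
xor-cancelʳ false true  false = refl
xor-cancelʳ false false true  = refl
xor-cancelʳ false false false = refl

hamming-refl : ∀ {h} (X : Word h) → hamming X X ≡ 0
hamming-refl []          = refl
hamming-refl (true  ∷ X) = hamming-refl X
hamming-refl (false ∷ X) = hamming-refl X

hamming-sym : ∀ {h} (X Y : Word h) → hamming X Y ≡ hamming Y X
hamming-sym []      []      = refl
hamming-sym (a ∷ X) (b ∷ Y) = cong₂ _+_ (cong indicator (xor-comm a b)) (hamming-sym X Y)

hamming-⊕ʳ : ∀ {h} (X Y C : Word h) → hamming (X ⊕ C) (Y ⊕ C) ≡ hamming X Y
hamming-⊕ʳ []      []      []      = refl
hamming-⊕ʳ (a ∷ X) (b ∷ Y) (c ∷ C) =
  cong₂ _+_ (cong indicator (xor-cancelʳ a b c)) (hamming-⊕ʳ X Y C)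

⊕-self : ∀ {h} (X : Word h) → X ⊕ X ≡ zeroWord h
⊕-self []          = refl
⊕-self (true  ∷ X) = cong (false ∷_) (⊕-self X)
⊕-self (false ∷ X) = cong (false ∷_) (⊕-self X)

hamming≡0⇒≡ : ∀ {h} (X Y : Word h) → hamming X Y ≡ 0 → X ≡ Y
hamming≡0⇒≡ []          []          _  = refl
hamming≡0⇒≡ (true  ∷ X) (true  ∷ Y) eq = cong (true ∷_) (hamming≡0⇒≡ X Y eq)
hamming≡0⇒≡ (false ∷ X) (false ∷ Y) eq = cong (false ∷_) (hamming≡0⇒≡ X Y eq)

hamming≡1⇒toggle : ∀ {h} (X Y : Word h) → hamming X Y ≡ 1 → ∃[ i ] Y ≡ toggle i X
hamming≡1⇒toggle [] [] ()
hamming≡1⇒toggle (true ∷ X) (true ∷ Y) eq with i , Y≡ ← hamming≡1⇒toggle X Y eq =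
  Fin.suc i , cong (true ∷_) Y≡
hamming≡1⇒toggle (false ∷ X) (false ∷ Y) eq with i , Y≡ ← hamming≡1⇒toggle X Y eq =
  Fin.suc i , cong (false ∷_) Y≡
hamming≡1⇒toggle (true ∷ X) (false ∷ Y) eq =
  Fin.zero , cong (false ∷_) (sym (hamming≡0⇒≡ X Y (suc-injective eq)))
hamming≡1⇒toggle (false ∷ X) (true ∷ Y) eq =
  Fin.zero , cong (true ∷_) (sym (hamming≡0⇒≡ X Y (suc-injective eq)))

hamming-toggleˡ : ∀ {h} i (X Y : Word h) → lookup X i ≡ lookup Y i →
                  hamming (toggle i X) Y ≡ suc (hamming X Y)
hamming-toggleˡ Fin.zero    (true  ∷ X) (true  ∷ Y) _ = refl
hamming-toggleˡ Fin.zero    (false ∷ X) (false ∷ Y) _ = refl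
hamming-toggleˡ (Fin.suc i) (a ∷ X)     (b ∷ Y)     eq =
  trans (cong (indicator (a xor b) +_) (hamming-toggleˡ i X Y eq)) (+-suc _ _)

hamming-toggleʳ : ∀ {h} i (X Y : Word h) → lookup X i ≡ lookup Y i →
                  hamming X (toggle i Y) ≡ suc (hamming X Y)
hamming-toggleʳ i X Y eq = begin
  hamming X (toggle i Y) ≡⟨ hamming-sym X _ ⟩
  hamming (toggle i Y) X ≡⟨ hamming-toggleˡ i Y X (sym eq) ⟩
  suc (hamming Y X)      ≡⟨ cong suc (hamming-sym Y X) ⟩
  suc (hamming X Y)      ∎

hamming-toggle : ∀ {h} i (X : Word h) → hamming X (toggle i X) ≡ 1
hamming-toggle i X = trans (hamming-toggleʳ i X X refl) (cong suc (hamming-refl X))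

hamming-toggle-both : ∀ {h} i (X Y : Word h) → hamming (toggle i X) (toggle i Y) ≡ hamming X Y
hamming-toggle-both Fin.zero    (true  ∷ X) (true  ∷ Y) = refl
hamming-toggle-both Fin.zero    (true  ∷ X) (false ∷ Y) = refl
hamming-toggle-both Fin.zero    (false ∷ X) (true  ∷ Y) = refl
hamming-toggle-both Fin.zero    (false ∷ X) (false ∷ Y) = refl
hamming-toggle-both (Fin.suc i) (a ∷ X)     (b ∷ Y)     =
  cong (indicator (a xor b) +_) (hamming-toggle-both i X Y)

toggle-involutive : ∀ {h} i (X : Word h) → toggle i (toggle i X) ≡ X
toggle-involutive Fin.zero    (a ∷ X) = cong (_∷ X) (not-involutive a)
toggle-involutive (Fin.suc i) (a ∷ X) = cong (a ∷_) (toggle-involutive i X)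

toggle-injectiveˡ : ∀ {h} {l j : Fin h} (X : Word h) → toggle l X ≡ toggle j X → l ≡ j
toggle-injectiveˡ {l = l} {j} X eq with l ≟ j
... | yes l≡j = l≡j
... | no  l≢j = contradiction (sym not-Xl≡Xl) (not-¬ refl)
  where
  not-Xl≡Xl : not (lookup X l) ≡ lookup X l
  not-Xl≡Xl = begin
    not (lookup X l)        ≡⟨ sym (lookup∘updateAt l X) ⟩
    lookup (toggle l X) l   ≡⟨ cong (λ Y → lookup Y l) eq ⟩
    lookup (toggle j X) l   ≡⟨ lookup∘updateAt′ l j l≢j X ⟩
    lookup X l              ∎

hamming-three-toggles : ∀ {h} {q i p : Fin h} (X : Word h) → q ≢ i → q ≢ p → i ≢ p →
                        hamming (toggle q X) (toggle i (toggle p X)) ≡ 3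
hamming-three-toggles {q = q} {i} {p} X q≢i q≢p i≢p = begin
  hamming (toggle q X) (toggle i (toggle p X))
    ≡⟨ hamming-toggleˡ q X _ (sym (trans (lookup∘updateAt′ q i q≢i (toggle p X)) (lookup∘updateAt′ q p q≢p X))) ⟩
  suc (hamming X (toggle i (toggle p X)))
    ≡⟨ cong suc (hamming-toggleʳ i X _ (sym (lookup∘updateAt′ i p i≢p X))) ⟩
  suc (suc (hamming X (toggle p X)))
    ≡⟨ cong (suc ∘ suc) (hamming-toggle p X) ⟩
  3 ∎

toggle-adjacent-to-two-toggles : ∀ {h} {q i p : Fin h} (X : Word h) → i ≢ p →
  hamming (toggle q X) (toggle i (toggle p X)) ≡ 1 → q ≡ i ⊎ q ≡ p
toggle-adjacent-to-two-toggles {q = q} {i} {p} X i≢p adjacent with q ≟ i | q ≟ p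
... | yes q≡i | _       = inj₁ q≡i
... | no  _   | yes q≡p = inj₂ q≡p
... | no  q≢i | no  q≢p =
  contradiction (trans (sym adjacent) (hamming-three-toggles X q≢i q≢p i≢p)) λ ()

weight-toggle-false : ∀ {h} i (X : Word h) → lookup X i ≡ false → weight (toggle i X) ≡ suc (weight X)
weight-toggle-false i X Xi = hamming-toggleʳ i (zeroWord _) X (trans (lookup-replicate i false) (sym Xi))

weight-toggle-true : ∀ {h} i (X : Word h) → lookup X i ≡ true → weight X ≡ suc (weight (toggle i X))
weight-toggle-true i X Xi = begin
  weight X                        ≡⟨ cong weight (sym (toggle-involutive i X)) ⟩
  weight (toggle i (toggle i X))  ≡⟨ weight-toggle-false i _ (trans (lookup∘updateAt i X) (cong not Xi)) ⟩
  suc (weight (toggle i X))       ∎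

weight-toggle-decreasing⇒true : ∀ {h} i (X : Word h) → weight X ≡ suc (weight (toggle i X)) →
                                lookup X i ≡ true
weight-toggle-decreasing⇒true i X decreasing with lookup X i in Xi
... | true  = refl
... | false = contradiction (trans decreasing (cong suc (weight-toggle-false i X Xi))) (m≢1+n+m _)

≤w-refl : ∀ {h} (X : Word h) → X ≤w X
≤w-refl X = Pointwise.refl ≤ᵇ-refl

zeroWord-≤w : ∀ {h} (X : Word h) → zeroWord h ≤w X
zeroWord-≤w []          = []
zeroWord-≤w (true  ∷ X) = f≤t ∷ zeroWord-≤w X
zeroWord-≤w (false ∷ X) = b≤b ∷ zeroWord-≤w X

toggle-≤w : ∀ {h} i (X : Word h) → lookup X i ≡ true → toggle i X ≤w X
toggle-≤w Fin.zero    (true ∷ X) _  = f≤t ∷ ≤w-refl X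
toggle-≤w (Fin.suc i) (a ∷ X)    Xi = ≤ᵇ-refl ∷ toggle-≤w i X Xi

≤w-descend : ∀ {h k} (Z X : Word h) → Z ≤w X → hamming Z X ≡ suc k →
             ∃[ i ] lookup X i ≡ true × Z ≤w toggle i X × hamming Z (toggle i X) ≡ k
≤w-descend (false ∷ Z) (true ∷ X) (f≤t ∷ Z≤X) eq = Fin.zero , refl , b≤b ∷ Z≤X , suc-injective eq
≤w-descend (true ∷ Z) (true ∷ X) (b≤b ∷ Z≤X) eq
  with i , Xi , Z≤X′ , eq′ ← ≤w-descend Z X Z≤X eq = Fin.suc i , Xi , b≤b ∷ Z≤X′ , eq′
≤w-descend (false ∷ Z) (false ∷ X) (b≤b ∷ Z≤X) eq
  with i , Xi , Z≤X′ , eq′ ← ≤w-descend Z X Z≤X eq = Fin.suc i , Xi , b≤b ∷ Z≤X′ , eq′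

weight≡suc⇒true : ∀ {h k} (X : Word h) → weight X ≡ suc k → ∃[ i ] lookup X i ≡ true
weight≡suc⇒true X eq with i , Xi , _ ← ≤w-descend _ X (zeroWord-≤w X) eq = i , Xi

DownClosed : ∀ {A : Set} {h} → (A → Word h) → Set
DownClosed β = ∀ {w Z} → Z ≤w β w → ∃[ y ] β y ≡ Z

ToggleClosed : ∀ {A : Set} {h} → (A → Word h) → Set
ToggleClosed β = ∀ w i → lookup (β w) i ≡ true → ∃[ y ] β y ≡ toggle i (β w)

toggleClosed⇒downClosed : ∀ {A : Set} {h} (β : A → Word h) → ToggleClosed β → DownClosed β
toggleClosed⇒downClosed β closed {w} {Z} Z≤βw = descend _ w Z≤βw refl
  where
  descend : ∀ k x → Z ≤w β x → hamming Z (β x) ≡ k → ∃[ y ] β y ≡ Z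
  descend zero    x _     eq = x , sym (hamming≡0⇒≡ Z (β x) eq)
  descend (suc k) x Z≤βx eq
    with i , βxi , Z≤βx′ , eq′ ← ≤w-descend Z (β x) Z≤βx eq
    with y , βy ← closed x i βxi
    = descend k y (subst (Z ≤w_) (sym βy) Z≤βx′) (trans (cong (hamming Z) βy) eq′)

toggle-below-toggle : ∀ {h} {j l : Fin h} (C D E : Word h) → lookup C j ≡ true →
                      D ≡ toggle j C → E ≡ toggle l D → weight D ≡ suc (weight E) →
                      lookup C l ≡ true × l ≢ j
toggle-below-toggle {j = j} {l} C D E Cj D≡ E≡ decreasing = Cl , l≢j
  where
  Dl : lookup D l ≡ true
  Dl = weight-toggle-decreasing⇒true l D (trans decreasing (cong (suc ∘ weight) E≡))

  l≢j : l ≢ j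
  l≢j refl = contradiction (trans (sym Dl) (trans (cong (λ X → lookup X j) D≡) (lookup∘updateAt j C)))
                          (not-¬ (sym Cj))

  Cl : lookup C l ≡ true
  Cl = trans (sym (lookup∘updateAt′ l j l≢j C)) (trans (cong (λ X → lookup X l) (sym D≡)) Dl)

toggle-transfer : ∀ {A : Set} {h} (F F′ : A → Word h) →
                  (∀ x y → hamming (F x) (F y) ≡ hamming (F′ x) (F′ y)) →
                  ∀ {x y j} → F y ≡ toggle j (F x) → ∃[ p ] F′ y ≡ toggle p (F′ x)
toggle-transfer F F′ same {x} {y} {j} Fy≡ = hamming≡1⇒toggle (F′ x) (F′ y) (begin
  hamming (F′ x) (F′ y)            ≡⟨ sym (same x y) ⟩
  hamming (F x) (F y)              ≡⟨ cong (hamming (F x)) Fy≡ ⟩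
  hamming (F x) (toggle j (F x))   ≡⟨ hamming-toggle j (F x) ⟩
  1                                ∎)

module SharedDistances {A : Set} {h} (γ β : A → Word h)
  (same-distances : ∀ x y → hamming (γ x) (γ y) ≡ hamming (β x) (β y))
  {o : A} (γo≡0 : γ o ≡ zeroWord h) (βo≡0 : β o ≡ zeroWord h)
  (γ-downClosed : DownClosed γ) where

  same-weight : ∀ x → weight (γ x) ≡ weight (β x)
  same-weight x =
    subst₂ (λ O O′ → hamming O (γ x) ≡ hamming O′ (β x)) γo≡0 βo≡0 (same-distances o x)

  lower-neighbour : ∀ w j → lookup (γ w) j ≡ true →
                    ∃[ w′ ] γ w′ ≡ toggle j (γ w) × ∃[ p ] β w′ ≡ toggle p (β w)
  lower-neighbour w j γwj with w′ , γw′ ← γ-downClosed (toggle-≤w j (γ w) γwj) =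
    w′ , γw′ , toggle-transfer γ β same-distances γw′

  γ-weight-step : ∀ {x y i} → β y ≡ toggle i (β x) → lookup (β x) i ≡ true →
                  weight (γ x) ≡ suc (weight (γ y))
  γ-weight-step {x} {y} {i} βy≡ βxi = begin
    weight (γ x)                   ≡⟨ same-weight x ⟩
    weight (β x)                   ≡⟨ weight-toggle-true i (β x) βxi ⟩
    suc (weight (toggle i (β x)))  ≡⟨ cong (suc ∘ weight) (sym βy≡) ⟩
    suc (weight (β y))             ≡⟨ cong suc (sym (same-weight y)) ⟩
    suc (weight (γ y))             ∎

  ToggleClosedAt : ℕ → Set
  ToggleClosedAt k = ∀ w → weight (β w) ≡ k → ∀ i → lookup (β w) i ≡ true →
                     ∃[ y ] β y ≡ toggle i (β w)

  toggleClosedAt-suc : ∀ {k} → ToggleClosedAt k → ToggleClosedAt (suc k)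
  toggleClosedAt-suc {k} ih w βw≡1+k i βwi
    with j , γwj ← weight≡suc⇒true (γ w) (trans (same-weight w) βw≡1+k)
    with w′ , γw′ , p , βw′ ← lower-neighbour w j γwj
    with i ≟ p
  ... | yes refl = w′ , βw′
  ... | no  i≢p = toggle-other-bit
    where
    -- The bit l that γ clears from w′ to y₀ is also set in γ w; clearing it there gives y₁, and
    -- β y₁ is adjacent both to β w and to β y₀ = toggle i (toggle p (β w)), so it clears i or p.
    weight-w′ : weight (β w′) ≡ k
    weight-w′ = suc-injective (begin
      suc (weight (β w′))            ≡⟨ cong suc (sym (same-weight w′)) ⟩
      suc (weight (γ w′))            ≡⟨ cong (suc ∘ weight) γw′ ⟩
      suc (weight (toggle j (γ w)))  ≡⟨ sym (weight-toggle-true j (γ w) γwj) ⟩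
      weight (γ w)                   ≡⟨ trans (same-weight w) βw≡1+k ⟩
      suc k                          ∎)

    βw′i : lookup (β w′) i ≡ true
    βw′i = trans (cong (λ X → lookup X i) βw′) (trans (lookup∘updateAt′ i p i≢p (β w)) βwi)

    toggle-other-bit : ∃[ y ] β y ≡ toggle i (β w)
    toggle-other-bit
      with y₀ , βy₀ ← ih w′ weight-w′ i βw′i
      with l , γy₀ ← toggle-transfer β γ (λ x y → sym (same-distances x y)) βy₀
      with γwl , l≢j ← toggle-below-toggle (γ w) (γ w′) (γ y₀) γwj γw′ γy₀ (γ-weight-step βy₀ βw′i)
      with y₁ , γy₁ , q , βy₁ ← lower-neighbour w l γwl
      with toggle-adjacent-to-two-toggles (β w) i≢p (begin
             hamming (toggle q (β w)) (toggle i (toggle p (β w)))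
               ≡⟨ sym (cong₂ hamming βy₁ (trans βy₀ (cong (toggle i) βw′))) ⟩
             hamming (β y₁) (β y₀)
               ≡⟨ sym (same-distances y₁ y₀) ⟩
             hamming (γ y₁) (γ y₀)
               ≡⟨ cong₂ hamming γy₁ (trans γy₀ (cong (toggle l) γw′)) ⟩
             hamming (toggle l (γ w)) (toggle l (toggle j (γ w)))
               ≡⟨ hamming-toggle-both l (γ w) _ ⟩
             hamming (γ w) (toggle j (γ w))
               ≡⟨ hamming-toggle j (γ w) ⟩
             1 ∎)
    ... | inj₁ refl = y₁ , βy₁
    ... | inj₂ refl = contradiction (toggle-injectiveˡ (γ w) (begin
            toggle l (γ w)  ≡⟨ sym γy₁ ⟩
            γ y₁            ≡⟨ hamming≡0⇒≡ (γ y₁) (γ w′) (trans (same-distances y₁ w′)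
                                 (trans (cong₂ hamming βy₁ βw′) (hamming-refl (toggle q (β w))))) ⟩
            γ w′            ≡⟨ γw′ ⟩
            toggle j (γ w)  ∎)) l≢j

  toggleClosedAt : ∀ k → ToggleClosedAt k
  toggleClosedAt zero    w βw≡0 i βwi =
    contradiction (trans (sym βw≡0) (weight-toggle-true i (β w) βwi)) λ ()
  toggleClosedAt (suc k) = toggleClosedAt-suc (toggleClosedAt k)

  β-downClosed : DownClosed β
  β-downClosed = toggleClosed⇒downClosed β (λ w → toggleClosedAt _ w refl)

dist-unique : ∀ (G : Graph) {x y k m} → IsDist G x y k → IsDist G x y m → k ≡ m
dist-unique G (walk-k , k-minimal) (walk-m , m-minimal) =
  ≤-antisym (k-minimal _ walk-m) (m-minimal _ walk-k)

isometric-⊕ʳ : ∀ (G : Graph) {h} (β : V G → Word h) → IsIsometric G h β →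
               ∀ C → IsIsometric G h (λ w → β w ⊕ C)
isometric-⊕ʳ G β iso C x y = subst (IsDist G x y) (sym (hamming-⊕ʳ (β x) (β y) C)) (iso x y)

isometric⇒injective : ∀ (G : Graph) {h} (β : V G → Word h) → IsIsometric G h β →
                      ∀ x y → β x ≡ β y → x ≡ y
isometric⇒injective G β iso x y βx≡βy
  with subst (Walk G x y) (trans (cong (hamming (β x)) (sym βx≡βy)) (hamming-refl (β x))) (proj₁ (iso x y))
... | here = refl

isometric⇒adjacent⇔distance1 : ∀ (G : Graph) {h} (β : V G → Word h) → IsIsometric G h β →
                               ∀ x y → Adj G x y ⇔ (hamming (β x) (β y) ≡ 1)
isometric⇒adjacent⇔distance1 G β iso x y = mk⇔ to from
  where
  to : Adj G x y → hamming (β x) (β y) ≡ 1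
  to xy with n≤1⇒n≡0∨n≡1 (proj₂ (iso x y) 1 (step xy here))
  ... | inj₂ distance1 = distance1
  ... | inj₁ distance0 with isometric⇒injective G _ iso x y (hamming≡0⇒≡ (β x) (β y) distance0)
  ...   | refl = ⊥-elim (subst T (irrefl G x) xy)

  from : hamming (β x) (β y) ≡ 1 → Adj G x y
  from distance1 with subst (Walk G x y) distance1 (proj₁ (iso x y))
  ... | step xy here = xy

isometric∧downClosed⇒proper : ∀ (G : Graph) {h} (β : V G → Word h) → IsIsometric G h β →
                              DownClosed β → IsProper G h β
isometric∧downClosed⇒proper G β iso closed =
  iso , β , (λ x → β x , (x , refl) , ≤w-refl (β x)) , isometric⇒injective G _ iso ,
  (λ { Z (_ , (x , refl) , Z≤βx) → closed Z≤βx }) , isometric⇒adjacent⇔distance1 G β iso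

proper⇒downClosed : ∀ (G : Graph) {h} (γ : V G → Word h) → IsProper G h γ → DownClosed γ
proper⇒downClosed G γ (iso , f , _ , _ , f-onto , _) = closed
  where
  -- The isomorphism f onto Q_h(γ(V)) need not be γ, but pulling γ back along f gives an
  -- injective self-map of the finite vertex set, which is therefore onto.
  pull : V G → V G
  pull x = proj₁ (f-onto (γ x) (γ x , (x , refl) , ≤w-refl (γ x)))

  pull-spec : ∀ x → f (pull x) ≡ γ x
  pull-spec x = proj₂ (f-onto (γ x) (γ x , (x , refl) , ≤w-refl (γ x)))

  pull-injective : Injective _≡_ _≡_ pull
  pull-injective {x} {y} pull-x≡pull-y = isometric⇒injective G _ iso x y
    (trans (sym (pull-spec x)) (trans (cong f pull-x≡pull-y) (pull-spec y)))

  closed : DownClosed γ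
  closed {w} {Z} Z≤γw
    with x₀ , fx₀ ← f-onto Z (γ w , (w , refl) , Z≤γw)
    with x , pull-x ← injective⇒surjective pull-injective x₀
    = x , trans (sym (pull-spec x)) (trans (cong f pull-x) fx₀)

lemma5 : (G : Graph) (h : ℕ) → IsDaisyCube G h →
         (v u : V G) → IsMinimal G h v → degree G u ≡ h →
         (β : V G → Word h) → IsIsometric G h β → β u ≡ zeroWord h →
         IsProper G h (λ w → β w ⊕ β v)
lemma5 G h _ v _ (γ , γ-proper , γv≡0) _ β β-iso _ =
  isometric∧downClosed⇒proper G b b-iso (SharedDistances.β-downClosed γ b same-distances γv≡0
    (⊕-self (β v)) (proper⇒downClosed G γ γ-proper))
  where
  b : V G → Word h
  b w = β w ⊕ β v

  b-iso : IsIsometric G h b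
  b-iso = isometric-⊕ʳ G β β-iso (β v)

  same-distances : ∀ x y → hamming (γ x) (γ y) ≡ hamming (b x) (b y)
  same-distances x y = dist-unique G (proj₁ γ-proper x y) (b-iso x y)
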